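{- Let $T$ be a tree of order $n$ belonging to the family $\mathcal{T}_\Delta$, with underlying subtrees $T_1,\ldots,T_k$. Then (a) $F_t(T) = \frac{1}{\Delta}\big((\Delta - 1)n + 1\big)$; and (b) the set consisting of all vertices of $T$ except, for each $i\in\{1,\ldots,k\}$, exactly one leaf neighbor in $T$ of the central vertex of $T_i$, is a minimum TF-set of $T$.
   Context: Forcing process: given a graph $G$ and an initial set $S \subseteq V(G)$ of colored vertices, at each step a colored vertex that has exactly one non-colored neighbor forces (colors) that neighbor. $S$ is a forcing set if iterating this eventually colors all of $V(G)$. A total forcing set (TF-set) is a forcing set $S$ such that $G[S]$ has no isolated vertex; $F_t(G)$ is the minimum cardinality of a TF-set. A leaf is a vertex of degree $1$; a strong support vertex is a vertex adjacent to at least two leaves. The family $\mathcal{T}_{\Delta}$ consists of all trees $T$ with maximum degree $\Delta$ whose vertex set can be partitioned into sets $V_1,\ldots,V_k$ ($k\ge1$) such that, with $T_i = T[V_i]$: (i) $T_1 \cong K_{1,\Delta}$, and if $k \ge 2$ then $T_i \cong K_{1,\Delta-1}$ for $i \in \{2,\ldots,k\}$; (ii) for each $i$, the central vertex $v_i$ of the star $T_i$ is a strong support vertex of degree $\Delta$ in $T$; (iii) $\{v_1,\ldots,v_k\}$ is independent in $T$. The trees $T_1,\ldots,T_k$ are called the underlying subtrees of $T$. -}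

module Defs where

open import Data.Nat using (ℕ; zero; suc; _+_; _*_; _∸_; _≤_)
open import Data.Fin using (Fin; zero; suc; _≟_)
open import Relation.Nullary.Decidable using (⌊_⌋)
open import Data.Empty using (⊥)
open import Data.Fin.Subset using (Subset; _∈_; _∉_; ∣_∣)
open import Data.Vec using (tabulate)
open import Data.Bool using (Bool; true; false)
open import Data.List using (List; _∷_; []; length; last)
open import Data.List.Relation.Unary.Linked using (Linked)
open import Data.List.Relation.Unary.Unique.Propositional using (Unique)
open import Data.Maybe using (just)
open import Data.Product using (Σ; ∃; ∃-syntax; _×_; _,_)
open import Relation.Binary.PropositionalEquality using (_≡_; _≢_)
open import Relation.Nullary using (¬_)

record Graph (n : ℕ) : Set where
  field
    adj     : Fin n → Fin n → Bool
    adj-sym : ∀ u v → adj u v ≡ adj v u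
    irrefl  : ∀ v → adj v v ≡ false

module _ {n : ℕ} (G : Graph n) where
  open Graph G

  Adj : Fin n → Fin n → Set
  Adj u v = adj u v ≡ true

  N : Fin n → Subset n
  N u = tabulate (adj u)

  deg : Fin n → ℕ
  deg u = ∣ N u ∣

  MaxDegree : ℕ → Set
  MaxDegree Δ = (∀ v → deg v ≤ Δ) × (∃[ v ] deg v ≡ Δ)

  IsLeaf : Fin n → Set
  IsLeaf v = deg v ≡ 1

  StrongSupport : Fin n → Set
  StrongSupport v = ∃[ a ] ∃[ b ] (a ≢ b × Adj v a × Adj v b × IsLeaf a × IsLeaf b)

  data Walk : Fin n → Fin n → Set where
    here : ∀ {v} → Walk v v
    step : ∀ {u w v} → Adj u w → Walk w v → Walk u v

  Connected : Set
  Connected = ∀ u v → Walk u v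

  IsCycle : List (Fin n) → Set
  IsCycle [] = ⊥
  IsCycle (x ∷ []) = ⊥
  IsCycle (x ∷ y ∷ []) = ⊥
  IsCycle xs@(x ∷ y ∷ z ∷ rest) =
    Unique xs × Linked Adj xs × (∀ l → last xs ≡ just l → Adj l x)

  Acyclic : Set
  Acyclic = ∀ xs → ¬ IsCycle xs

  IsTree : Set
  IsTree = Connected × Acyclic

  -- Forcing: vertices eventually coloured starting from S
  -- (closure of S under the colour-change rule: a coloured vertex u
  -- all of whose neighbours other than v are coloured forces v)
  data Coloured (S : Subset n) : Fin n → Set where
    init  : ∀ {v} → v ∈ S → Coloured S v
    force : ∀ {u v} → Adj u v → Coloured S u →
            (∀ w → Adj u w → w ≢ v → Coloured S w) → Coloured S v

  ForcingSet : Subset n → Set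
  ForcingSet S = ∀ v → Coloured S v

  NoIsolatedIn : Subset n → Set
  NoIsolatedIn S = ∀ v → v ∈ S → ∃[ u ] (u ∈ S × Adj v u)

  TFSet : Subset n → Set
  TFSet S = ForcingSet S × NoIsolatedIn S

  MinTFSet : Subset n → Set
  MinTFSet S = TFSet S × (∀ S′ → TFSet S′ → ∣ S ∣ ≤ ∣ S′ ∣)

  TotalForcingNumber : ℕ → Set
  TotalForcingNumber m =
    (∃[ S ] (TFSet S × ∣ S ∣ ≡ m)) × (∀ S′ → TFSet S′ → m ≤ ∣ S′ ∣)

  -- The family 𝒯_Δ.  A witness consists of k ≥ 1 (written suc k′),
  -- a partition map part : V → Fin k (V_i = part⁻¹(i), T_1 = part index 0)
  -- and the centres c i of the stars T_i.

  -- T[V] ≅ K_{1,m} with central vertex c, where V = {v | part v ≡ i}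
  IsStar : ∀ {k} → (Fin n → Fin k) → Fin k → Fin n → ℕ → Set
  IsStar part i c m =
    part c ≡ i ×
    (∀ v → part v ≡ i → v ≢ c → Adj c v) ×
    (∀ u v → part u ≡ i → part v ≡ i → u ≢ c → v ≢ c → ¬ Adj u v) ×
    ∣ tabulate (λ v → ⌊ part v ≟ i ⌋) ∣ ≡ suc m

  record InFamily (Δ : ℕ) (k : ℕ) : Set where
    field
      maxdeg      : MaxDegree Δ
      part        : Fin n → Fin (suc k)
      centre      : Fin (suc k) → Fin n
      star₁       : IsStar part zero (centre zero) Δ
      stars       : ∀ (i : Fin k) → IsStar part (suc i) (centre (suc i)) (Δ ∸ 1)
      centreSS    : ∀ i → StrongSupport (centre i)
      centreDeg   : ∀ i → deg (centre i) ≡ Δ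
      independent : ∀ i j → ¬ Adj (centre i) (centre j)

module Submission where

-- Write Δ = d + 1 and let c₀, …, c_k be the centres of the k + 1 underlying
-- stars T₀ ≅ K_{1,Δ} and T₁, …, T_k ≅ K_{1,d}.  Counting the vertices star by
-- star gives n = m + (k + 1) with m = Δ + kd, and the theorem says that
-- F_t(T) = m, attained by every set obtained by deleting one leaf ℓ_i at each
-- centre c_i; arithmetic then gives Δ·m = (Δ - 1)·n + 1.
--
-- A strong support vertex lies in every TF-set, since otherwise
-- its two leaves form a fort, a set into which nothing can ever force.  In a
-- tree of the family every edge meets a centre: the centre of each star T_i
-- (i ≥ 1) has one edge leaving T_i, following these edges leads from every
-- star to T₀, and an edge between two non-centres would then close a cycle.
-- If a forcing set S contains a vertex cover {c₀, …, c_k}, every force is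
-- performed by some c_i and each c_i forces at most once, so |V ∖ S| ≤ k + 1,
-- that is |S| ≥ m.
--
-- Upper bound.  With S = V ∖ {ℓ₀, …, ℓ_k} each c_i forces ℓ_i, S induces no
-- isolated vertex, and the ℓ_i are distinct, so |S| = m.

open import Defs
open import Data.Nat using (ℕ; zero; suc; _+_; _*_; _∸_; _≤_; _<_; z≤n; s≤s)
import Data.Nat.Properties as ℕ
open import Data.Nat.GeneralisedArithmetic using (iterate)
open import Data.Nat.Solver using (module +-*-Solver)
open import Algebra.Properties.CommutativeSemigroup ℕ.+-commutativeSemigroup using (interchange)
open import Data.Fin using (Fin; zero; suc; _≟_; toℕ)
open import Data.Fin.Properties using (any?; all?; pigeonhole; suc-injective; 0≢1+n)
open import Data.Fin.Subset using (Subset; _∈_; _∉_; ∣_∣; ⁅_⁆; _∪_; _-_; ∁; _⊆_; _⊂_; inside; outside)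
open import Data.Fin.Subset.Properties
  using ( _∈?_; nonempty?; Empty-unique; ∣⊥∣≡0; ∣p∣≤n; ∣⁅x⁆∣≡1; x∈⁅x⁆; x∈⁅y⁆⇒x≡y
        ; p⊆q⇒∣p∣≤∣q∣; p⊂q⇒∣p∣<∣q∣; p⊂q⇒∁p⊃∁q; x∈∁p⇒x∉p; x∉p⇒x∈∁p; ∣∁p∣≡n∸∣p∣
        ; p⊆p∪q; x∈p∪q⁺; x∈p∪q⁻; ∪-identityʳ; x∈p∧x≢y⇒x∈p-y; x∈p⇒∣p-x∣<∣p∣ )
open import Data.Vec using (tabulate; _∷_)
open import Data.Vec.Properties using (lookup∘tabulate; []=⇒lookup; lookup⇒[]=)
open import Data.Bool using (Bool; true; false) renaming (_≟_ to _≟ᵇ_)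
open import Data.List using (List; []; _∷_; _++_; last)
open import Data.List.Relation.Unary.All using ([])
open import Data.List.Relation.Unary.All.Properties using (¬Any⇒All¬)
open import Data.List.Relation.Unary.AllPairs using ([]; _∷_)
open import Data.List.Relation.Unary.Linked as Linked using (Linked; [-]; _∷_)
open import Data.List.Relation.Unary.Unique.Propositional using (Unique)
open import Data.List.Membership.Propositional.Properties using (∈-∃++)
open import Data.Maybe using (just)
open import Data.Maybe.Properties using (just-injective)
open import Data.Product using (Σ; ∃-syntax; _×_; _,_; proj₁; proj₂)
open import Data.Sum using (_⊎_; inj₁; inj₂; [_,_])
open import Data.Empty using (⊥-elim)
open import Function using (_∘_)
open import Relation.Binary.PropositionalEquality hiding ([_])
open import Relation.Binary.Construct.Closure.ReflexiveTransitive as Star using (Star; ε; _◅_; _◅◅_)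
open import Relation.Nullary using (¬_; Dec; yes; no)
open import Relation.Nullary.Decidable using (⌊_⌋; ¬?; _×-dec_; _→-dec_; decidable-stable)
open import Relation.Unary using (Decidable)

⌊⌋-sound : ∀ {A : Set} (a? : Dec A) → ⌊ a? ⌋ ≡ true → A
⌊⌋-sound (yes a) _ = a

⌊⌋-complete : ∀ {A : Set} (a? : Dec A) → A → ⌊ a? ⌋ ≡ true
⌊⌋-complete (yes _) _ = refl
⌊⌋-complete (no ¬a) a = ⊥-elim (¬a a)

∈-tabulate⁻ : ∀ {n} (f : Fin n → Bool) {x} → x ∈ tabulate f → f x ≡ true
∈-tabulate⁻ f {x} x∈ = trans (sym (lookup∘tabulate f x)) ([]=⇒lookup x∈)

∈-tabulate⁺ : ∀ {n} (f : Fin n → Bool) {x} → f x ≡ true → x ∈ tabulate f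
∈-tabulate⁺ f {x} fx = lookup⇒[]= x (tabulate f) (trans (lookup∘tabulate f x) fx)

select : ∀ {n} {P : Fin n → Set} → Decidable P → Subset n
select P? = tabulate (λ x → ⌊ P? x ⌋)

∈-select⁻ : ∀ {n} {P : Fin n → Set} (P? : Decidable P) {x} → x ∈ select P? → P x
∈-select⁻ P? {x} x∈ = ⌊⌋-sound (P? x) (∈-tabulate⁻ _ x∈)

∈-select⁺ : ∀ {n} {P : Fin n → Set} (P? : Decidable P) {x} → P x → x ∈ select P?
∈-select⁺ P? {x} px = ∈-tabulate⁺ _ (⌊⌋-complete (P? x) px)

∈⇒0<∣p∣ : ∀ {n} {p : Subset n} {x} → x ∈ p → 0 < ∣ p ∣
∈⇒0<∣p∣ {p = p} {x} x∈p = subst (_≤ ∣ p ∣) (∣⁅x⁆∣≡1 x) (p⊆q⇒∣p∣≤∣q∣ ⁅x⁆⊆p)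
  where
    ⁅x⁆⊆p : ⁅ x ⁆ ⊆ p
    ⁅x⁆⊆p y∈⁅x⁆ = subst (_∈ p) (sym (x∈⁅y⁆⇒x≡y x y∈⁅x⁆)) x∈p

∣p∣≡1⇒x≡y : ∀ {n} {p : Subset n} {x y} → ∣ p ∣ ≡ 1 → x ∈ p → y ∈ p → x ≡ y
∣p∣≡1⇒x≡y {p = p} {x} {y} ∣p∣≡1 x∈p y∈p with x ≟ y
... | yes x≡y = x≡y
... | no x≢y = ⊥-elim (ℕ.<-irrefl (trans (∣⁅x⁆∣≡1 x) (sym ∣p∣≡1)) (p⊂q⇒∣p∣<∣q∣ ⁅x⁆⊂p))
  where
    ⁅x⁆⊂p : ⁅ x ⁆ ⊂ p
    ⁅x⁆⊂p = (λ z∈⁅x⁆ → subst (_∈ p) (sym (x∈⁅y⁆⇒x≡y x z∈⁅x⁆)) x∈p)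
          , y , y∈p , λ y∈⁅x⁆ → x≢y (sym (x∈⁅y⁆⇒x≡y x y∈⁅x⁆))

∣p∪⁅x⁆∣≤1+∣p∣ : ∀ {n} (p : Subset n) x → ∣ p ∪ ⁅ x ⁆ ∣ ≤ suc ∣ p ∣
∣p∪⁅x⁆∣≤1+∣p∣ (outside ∷ p) zero rewrite ∪-identityʳ p = ℕ.≤-refl
∣p∪⁅x⁆∣≤1+∣p∣ (inside ∷ p) zero rewrite ∪-identityʳ p = ℕ.n≤1+n _
∣p∪⁅x⁆∣≤1+∣p∣ (outside ∷ p) (suc x) = ∣p∪⁅x⁆∣≤1+∣p∣ p x
∣p∪⁅x⁆∣≤1+∣p∣ (inside ∷ p) (suc x) = s≤s (∣p∪⁅x⁆∣≤1+∣p∣ p x)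

∣p∣+∣∁p∣≡n : ∀ {n} (p : Subset n) → ∣ p ∣ + ∣ ∁ p ∣ ≡ n
∣p∣+∣∁p∣≡n p = trans (cong (∣ p ∣ +_) (∣∁p∣≡n∸∣p∣ p)) (ℕ.m+[n∸m]≡n (∣p∣≤n p))

injective⇒K≤∣p∣ : ∀ {n} K (f : Fin K → Fin n) → (∀ {i j} → f i ≡ f j → i ≡ j) →
                  (p : Subset n) → (∀ i → f i ∈ p) → K ≤ ∣ p ∣
injective⇒K≤∣p∣ zero f f-inj p f∈p = z≤n
injective⇒K≤∣p∣ (suc K) f f-inj p f∈p =
  ℕ.≤-trans (s≤s (injective⇒K≤∣p∣ K (f ∘ suc) (suc-injective ∘ f-inj) (p - f zero) rest∈))
            (x∈p⇒∣p-x∣<∣p∣ (f∈p zero))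
  where
    rest∈ : ∀ i → f (suc i) ∈ p - f zero
    rest∈ i = x∈p∧x≢y⇒x∈p-y (f∈p (suc i)) (λ e → 0≢1+n (f-inj (sym e)))

∑ : ∀ K → (Fin K → ℕ) → ℕ
∑ zero f = 0
∑ (suc K) f = f zero + ∑ K (f ∘ suc)

∑-cong : ∀ K {f g : Fin K → ℕ} → (∀ i → f i ≡ g i) → ∑ K f ≡ ∑ K g
∑-cong zero f≡g = refl
∑-cong (suc K) f≡g = cong₂ _+_ (f≡g zero) (∑-cong K (f≡g ∘ suc))

∑-+ : ∀ K (f g : Fin K → ℕ) → ∑ K (λ i → f i + g i) ≡ ∑ K f + ∑ K g
∑-+ zero f g = refl
∑-+ (suc K) f g =
  trans (cong (f zero + g zero +_) (∑-+ K (f ∘ suc) (g ∘ suc))) (interchange (f zero) (g zero) _ _)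

∑-const : ∀ K x → ∑ K (λ _ → x) ≡ K * x
∑-const zero x = refl
∑-const (suc K) x = cong (x +_) (∑-const K x)

bit : Bool → ℕ
bit true = 1
bit false = 0

∣b∷p∣ : ∀ {n} b (p : Subset n) → ∣ b ∷ p ∣ ≡ bit b + ∣ p ∣
∣b∷p∣ true p = refl
∣b∷p∣ false p = refl

∑-point : ∀ K (j : Fin K) → ∑ K (λ i → bit ⌊ j ≟ i ⌋) ≡ 1
∑-point (suc K) zero = cong suc (trans (∑-const K 0) (ℕ.*-zeroʳ K))
∑-point (suc K) (suc j) = trans (∑-cong K bit-suc) (∑-point K j)
  where
    bit-suc : ∀ i → bit ⌊ suc j ≟ suc i ⌋ ≡ bit ⌊ j ≟ i ⌋
    bit-suc i with j ≟ i
    ... | yes _ = refl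
    ... | no _ = refl

∑-fibres : ∀ n K (g : Fin n → Fin K) → ∑ K (λ i → ∣ select (λ v → g v ≟ i) ∣) ≡ n
∑-fibres zero K g = trans (∑-const K 0) (ℕ.*-zeroʳ K)
∑-fibres (suc n) K g = begin
  ∑ K (λ i → ∣ select (λ v → g v ≟ i) ∣)
    ≡⟨ ∑-cong K (λ i → ∣b∷p∣ ⌊ g zero ≟ i ⌋ (select (λ v → g (suc v) ≟ i))) ⟩
  ∑ K (λ i → bit ⌊ g zero ≟ i ⌋ + ∣ select (λ v → g (suc v) ≟ i) ∣)
    ≡⟨ ∑-+ K _ _ ⟩
  ∑ K (λ i → bit ⌊ g zero ≟ i ⌋) + ∑ K (λ i → ∣ select (λ v → g (suc v) ≟ i) ∣)
    ≡⟨ cong₂ _+_ (∑-point K (g zero)) (∑-fibres n K (g ∘ suc)) ⟩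
  suc n ∎
  where open ≡-Reasoning

-- Walks and paths.  A walk is an element of the reflexive-transitive
-- closure Star R; a path is a duplicate-free walk, recorded as the list of
-- its vertices.

module _ {n : ℕ} {R : Fin n → Fin n → Set} where
  open import Data.List.Membership.DecPropositional (_≟_ {n}) using () renaming (_∈?_ to _∈ₗ?_)

  record Path (u v : Fin n) : Set where
    constructor path
    field
      rest   : List (Fin n)
      unique : Unique (u ∷ rest)
      linked : Linked R (u ∷ rest)
      ends   : last (u ∷ rest) ≡ just v

  unique-suffix : ∀ ys {xs : List (Fin n)} → Unique (ys ++ xs) → Unique xs
  unique-suffix [] u = u
  unique-suffix (y ∷ ys) (_ ∷ u) = unique-suffix ys u

  linked-suffix : ∀ ys {xs : List (Fin n)} → Linked R (ys ++ xs) → Linked R xs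
  linked-suffix [] l = l
  linked-suffix (y ∷ ys) l = linked-suffix ys (Linked.tail l)

  last-suffix : ∀ ys (x : Fin n) zs → last (ys ++ x ∷ zs) ≡ last (x ∷ zs)
  last-suffix [] x zs = refl
  last-suffix (y ∷ []) x zs = refl
  last-suffix (y ∷ y′ ∷ ys) x zs = last-suffix (y′ ∷ ys) x zs

  -- Every walk can be shortened to a path with the same end points: if the
  -- first vertex reappears later, continue from its last occurrence.
  walk⇒path : ∀ {u v} → Star R u v → Path u v
  walk⇒path ε = path [] ([] ∷ []) [-] refl
  walk⇒path {u} (_◅_ {j = w} r walk) with walk⇒path walk
  ... | path rs uniq lnk ends with u ∈ₗ? (w ∷ rs)
  ...   | no u∉ = path (w ∷ rs) (¬Any⇒All¬ (w ∷ rs) u∉ ∷ uniq) (r ∷ lnk) ends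
  ...   | yes u∈ with ∈-∃++ u∈
  ...     | ys , zs , split = path zs
              (unique-suffix ys (subst Unique split uniq))
              (linked-suffix ys (subst (Linked R) split lnk))
              (trans (sym (last-suffix ys u zs)) (trans (cong last (sym split)) ends))

module _ {n : ℕ} (G : Graph n) where
  open Graph G

  Adj-sym : ∀ {u v} → Adj G u v → Adj G v u
  Adj-sym {u} {v} uv = trans (adj-sym v u) uv

  no-loop : ∀ {v} → ¬ Adj G v v
  no-loop {v} vv with trans (sym (irrefl v)) vv
  ... | ()

  adj? : ∀ u v → Dec (Adj G u v)
  adj? u v = adj u v ≟ᵇ true

  Adj⇒∈N : ∀ {u v} → Adj G u v → v ∈ N G u
  Adj⇒∈N {u} uv = ∈-tabulate⁺ (adj u) uv

  leaf-neighbour-unique : ∀ {a u w} → IsLeaf G a → Adj G a u → Adj G a w → u ≡ w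
  leaf-neighbour-unique leaf au aw = ∣p∣≡1⇒x≡y leaf (Adj⇒∈N au) (Adj⇒∈N aw)

  some-leaf : ∀ {v} → StrongSupport G v → Σ (Fin n) λ a → Adj G v a × IsLeaf G a
  some-leaf (a , _ , _ , va , _ , leaf-a , _) = a , va , leaf-a

  acyclic-edge : ∀ {R : Fin n → Fin n → Set} → Acyclic G → (∀ {a b} → R a b → Adj G a b) →
                 ∀ {x y} → Adj G x y → ¬ R y x → ¬ Star R y x
  acyclic-edge {R} acyclic R⇒Adj {x} {y} xy ¬Ryx walk with walk⇒path walk
  ... | path [] _ _ ends with just-injective ends
  ...   | refl = no-loop xy
  acyclic-edge {R} acyclic R⇒Adj {x} {y} xy ¬Ryx walk | path (z ∷ []) _ (Ryz ∷ [-]) ends =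
    ¬Ryx (subst (R y) (just-injective ends) Ryz)
  acyclic-edge {R} acyclic R⇒Adj {x} {y} xy ¬Ryx walk | path (z ∷ z′ ∷ zs) uniq lnk ends =
    acyclic (y ∷ z ∷ z′ ∷ zs)
      (uniq , Linked.map R⇒Adj lnk ,
       λ l l-last → subst (λ a → Adj G a y) (just-injective (trans (sym ends) l-last)) xy)

  coloured-mono : ∀ {S S′ : Subset n} → S ⊆ S′ → ∀ {v} → Coloured G S v → Coloured G S′ v
  coloured-mono S⊆S′ (init v∈S) = init (S⊆S′ v∈S)
  coloured-mono S⊆S′ (force uv u-col others) =
    force uv (coloured-mono S⊆S′ u-col) (λ w uw w≢v → coloured-mono S⊆S′ (others w uw w≢v))

  Fort : Subset n → (Fin n → Set) → Set
  Fort S F = (∀ v → F v → v ∉ S) × (∀ u v → ¬ F u → Adj G u v → F v → ∃[ w ] (F w × w ≢ v × Adj G u w))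

  fort-uncoloured : ∀ {S F} → Fort S F → ∀ {v} → Coloured G S v → ¬ F v
  fort-uncoloured (disjoint , _) (init v∈S) Fv = disjoint _ Fv v∈S
  fort-uncoloured fort@(_ , guarded) (force {u} {v} uv u-col others) Fv
    with guarded u v (fort-uncoloured fort u-col) uv Fv
  ... | w , Fw , w≢v , uw = fort-uncoloured fort (others w uw w≢v) Fw

  -- A strong support vertex v lies in every TF-set S: otherwise its leaves
  -- lie outside S (each would be isolated in G[S]) and form a fort.
  strong-support∈TF : ∀ {v S} → StrongSupport G v → TFSet G S → v ∈ S
  strong-support∈TF {v} {S} (a , b , a≢b , va , vb , leaf-a , leaf-b) (forcing , no-isolated) with v ∈? S
  ... | yes v∈S = v∈S
  ... | no v∉S = ⊥-elim (fort-uncoloured (leaves∉S , guarded) (forcing a) (inj₁ refl))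
    where
      leaf∉S : ∀ {x} → IsLeaf G x → Adj G v x → x ∉ S
      leaf∉S leaf vx x∈S with no-isolated _ x∈S
      ... | u , u∈S , xu = v∉S (subst (_∈ S) (leaf-neighbour-unique leaf xu (Adj-sym vx)) u∈S)
      leaves∉S : ∀ x → x ≡ a ⊎ x ≡ b → x ∉ S
      leaves∉S _ (inj₁ refl) = leaf∉S leaf-a va
      leaves∉S _ (inj₂ refl) = leaf∉S leaf-b vb
      guarded : ∀ u x → ¬ (u ≡ a ⊎ u ≡ b) → Adj G u x → x ≡ a ⊎ x ≡ b →
                ∃[ w ] ((w ≡ a ⊎ w ≡ b) × w ≢ x × Adj G u w)
      guarded u _ _ ua (inj₁ refl) =
        b , inj₂ refl , (λ b≡a → a≢b (sym b≡a)) ,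
        subst (λ z → Adj G z b) (leaf-neighbour-unique leaf-a (Adj-sym va) (Adj-sym ua)) vb
      guarded u _ _ ub (inj₂ refl) =
        a , inj₁ refl , a≢b ,
        subst (λ z → Adj G z a) (leaf-neighbour-unique leaf-b (Adj-sym vb) (Adj-sym ub)) va

  Forces : Subset n → Fin n → Fin n → Set
  Forces S u v = Adj G u v × v ∉ S × (∀ w → Adj G u w → w ∉ S → w ≡ v)

  forces? : ∀ S u v → Dec (Forces S u v)
  forces? S u v = adj? u v ×-dec (¬? (v ∈? S) ×-dec all? (λ w → adj? u w →-dec (¬? (w ∈? S) →-dec (w ≟ v))))

  -- A forcing set that is not everything allows a first force; otherwise
  -- the vertices outside it would form a fort.
  forcing-step : ∀ S → ForcingSet G S → ∀ {x} → x ∉ S → ∃[ u ] ∃[ v ] Forces S u v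
  forcing-step S forcing {x} x∉S with any? (λ u → any? (forces? S u))
  ... | yes found = found
  ... | no none = ⊥-elim (fort-uncoloured ((λ _ v∉S → v∉S) , guarded) (forcing x) x∉S)
    where
      guarded : ∀ u v → ¬ (u ∉ S) → Adj G u v → v ∉ S → ∃[ w ] (w ∉ S × w ≢ v × Adj G u w)
      guarded u v _ uv v∉S with any? (λ w → adj? u w ×-dec (¬? (w ∈? S) ×-dec ¬? (w ≟ v)))
      ... | yes (w , uw , w∉S , w≢v) = w , w∉S , w≢v , uw
      ... | no no-second = ⊥-elim (none (u , v , uv , v∉S , only-v))
        where
          only-v : ∀ w → Adj G u w → w ∉ S → w ≡ v
          only-v w uw w∉S = decidable-stable (w ≟ v) (λ w≢v → no-second (w , uw , w∉S , w≢v))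

  Covers : ∀ {K} → (Fin K → Fin n) → Set
  Covers c = ∀ {u v} → Adj G u v → (∃[ i ] c i ≡ u) ⊎ (∃[ i ] c i ≡ v)

  module _ {K} (c : Fin K → Fin n) (covers : Covers c) where

    Exposed : Subset n → Subset K
    Exposed S = select (λ i → any? (λ v → adj? (c i) v ×-dec ¬? (v ∈? S)))

    -- A forcing set containing the cover: every force is made by some c i,
    -- after which c i is no longer exposed, so each c i forces at most once.
    uncoloured≤exposed : ∀ r S → ∣ ∁ S ∣ ≤ r → ForcingSet G S → (∀ i → c i ∈ S) →
                         ∣ ∁ S ∣ ≤ ∣ Exposed S ∣
    uncoloured≤exposed zero S bound _ _ = subst (_≤ ∣ Exposed S ∣) (sym (ℕ.n≤0⇒n≡0 bound)) z≤n
    uncoloured≤exposed (suc r) S bound forcing c∈S with nonempty? (∁ S)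
    ... | no empty = subst (_≤ ∣ Exposed S ∣) (sym (trans (cong ∣_∣ (Empty-unique empty)) (∣⊥∣≡0 n))) z≤n
    ... | yes (x , x∈∁S) with forcing-step S forcing (x∈∁p⇒x∉p x∈∁S)
    ...   | u , v , uv , v∉S , only-v with covers uv
    ...     | inj₂ (j , cj≡v) = ⊥-elim (v∉S (subst (_∈ S) cj≡v (c∈S j)))
    ...     | inj₁ (i , refl) = begin
      ∣ ∁ S ∣                  ≤⟨ p⊆q⇒∣p∣≤∣q∣ ∁S⊆∁S′∪⁅v⁆ ⟩
      ∣ ∁ S′ ∪ ⁅ v ⁆ ∣         ≤⟨ ∣p∪⁅x⁆∣≤1+∣p∣ (∁ S′) v ⟩
      suc ∣ ∁ S′ ∣             ≤⟨ s≤s (uncoloured≤exposed r S′ bound′ forcing′ (S⊆S′ ∘ c∈S)) ⟩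
      suc ∣ Exposed S′ ∣       ≤⟨ p⊂q⇒∣p∣<∣q∣ exposed-shrinks ⟩
      ∣ Exposed S ∣            ∎
      where
        open ℕ.≤-Reasoning
        S′ = S ∪ ⁅ v ⁆
        S⊆S′ : S ⊆ S′
        S⊆S′ = p⊆p∪q ⁅ v ⁆
        v∈S′ : v ∈ S′
        v∈S′ = x∈p∪q⁺ (inj₂ (x∈⁅x⁆ v))
        forcing′ : ForcingSet G S′
        forcing′ = coloured-mono S⊆S′ ∘ forcing
        bound′ : ∣ ∁ S′ ∣ ≤ r
        bound′ = ℕ.≤-pred (ℕ.≤-trans (p⊂q⇒∣p∣<∣q∣ (p⊂q⇒∁p⊃∁q (S⊆S′ , v , v∈S′ , v∉S))) bound)
        ∁S⊆∁S′∪⁅v⁆ : ∁ S ⊆ ∁ S′ ∪ ⁅ v ⁆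
        ∁S⊆∁S′∪⁅v⁆ {y} y∈∁S with y ≟ v
        ... | yes refl = x∈p∪q⁺ (inj₂ (x∈⁅x⁆ y))
        ... | no y≢v = x∈p∪q⁺ (inj₁ (x∉p⇒x∈∁p
                ([ x∈∁p⇒x∉p y∈∁S , (λ y∈⁅v⁆ → y≢v (x∈⁅y⁆⇒x≡y v y∈⁅v⁆)) ] ∘ x∈p∪q⁻ S ⁅ v ⁆)))
        exposed-shrinks : Exposed S′ ⊂ Exposed S
        exposed-shrinks =
            (λ j∈ → let (w , cjw , w∉S′) = ∈-select⁻ _ j∈ in ∈-select⁺ _ (w , cjw , w∉S′ ∘ S⊆S′))
          , i , ∈-select⁺ _ (v , uv , v∉S)
          , λ i∈ → let (w , ciw , w∉S′) = ∈-select⁻ _ i∈ in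
                   w∉S′ (subst (_∈ S′) (sym (only-v w ciw (w∉S′ ∘ S⊆S′))) v∈S′)

    cover-bound : ∀ S → ForcingSet G S → (∀ i → c i ∈ S) → ∣ ∁ S ∣ ≤ K
    cover-bound S forcing c∈S =
      ℕ.≤-trans (uncoloured≤exposed n S (∣p∣≤n (∁ S)) forcing c∈S) (∣p∣≤n (Exposed S))

-- The family is empty for Δ = 0: a strong support vertex has a neighbour.
no-family-with-Δ≡0 : ∀ {n} {T : Graph n} {k} → ¬ InFamily T 0 k
no-family-with-Δ≡0 {T = T} F with some-leaf T (InFamily.centreSS F zero)
... | _ , c₀a , _ = ℕ.<-irrefl (sym (InFamily.centreDeg F zero)) (∈⇒0<∣p∣ (Adj⇒∈N T c₀a))

iterate-+ : ∀ {A : Set} (f : A → A) x a b → iterate f x (a + b) ≡ iterate f (iterate f x a) b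
iterate-+ f x zero b = refl
iterate-+ f x (suc a) b = iterate-+ f (f x) a b

module Family {n : ℕ} {T : Graph n} {d k : ℕ} (acyclic : Acyclic T) (F : InFamily T (suc d) k) where
  open InFamily F

  V : Fin (suc k) → Subset n
  V i = select (λ v → part v ≟ i)

  part-centre : ∀ i → part (centre i) ≡ i
  part-centre zero = proj₁ star₁
  part-centre (suc m) = proj₁ (stars m)

  star-edge : ∀ {i v} → part v ≡ i → v ≢ centre i → Adj T (centre i) v
  star-edge {zero} = proj₁ (proj₂ star₁) _
  star-edge {suc m} = proj₁ (proj₂ (stars m)) _

  centre-injective : ∀ {i j} → centre i ≡ centre j → i ≡ j
  centre-injective {i} {j} e = trans (sym (part-centre i)) (trans (cong part e) (part-centre j))

  -- Being a centre is decidable: v is a centre iff it is the centre of its own star.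
  IsCentre : Fin n → Set
  IsCentre v = ∃[ i ] centre i ≡ v

  isCentre? : ∀ v → Dec (IsCentre v)
  isCentre? v with v ≟ centre (part v)
  ... | yes v≡c = yes (part v , sym v≡c)
  ... | no v≢c = no λ { (i , refl) → v≢c (cong centre (sym (part-centre i))) }

  attached : ∀ {v} → ¬ IsCentre v → Adj T (centre (part v)) v
  attached {v} ¬cv = star-edge refl (λ v≡c → ¬cv (part v , sym v≡c))

  -- The centre of star suc m has Δ neighbours but only d other vertices in
  -- its star, so some edge leaves the star.
  exit : ∀ m → Σ (Fin n) λ o → Adj T (centre (suc m)) o × part o ≢ suc m
  exit m with any? (λ v → adj? T (centre (suc m)) v ×-dec ¬? (part v ≟ suc m))
  ... | yes found = found
  ... | no none = ⊥-elim (ℕ.<-irrefl (trans (centreDeg (suc m)) (sym (proj₂ (proj₂ (proj₂ (stars m))))))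
                                     (p⊂q⇒∣p∣<∣q∣ N⊂V))
    where
      N⊂V : N T (centre (suc m)) ⊂ V (suc m)
      N⊂V = (λ {x} x∈N → ∈-select⁺ _ (decidable-stable (part x ≟ suc m)
                           (λ ne → none (x , ∈-tabulate⁻ _ x∈N , ne))))
          , centre (suc m) , ∈-select⁺ _ (part-centre (suc m))
          , λ c∈N → no-loop T (∈-tabulate⁻ _ c∈N)

  exit-vertex : Fin k → Fin n
  exit-vertex m = proj₁ (exit m)

  exit-adj : ∀ m → Adj T (centre (suc m)) (exit-vertex m)
  exit-adj m = proj₁ (proj₂ (exit m))

  exit-leaves : ∀ m → part (exit-vertex m) ≢ suc m
  exit-leaves m = proj₂ (proj₂ (exit m))

  exit-not-centre : ∀ m → ¬ IsCentre (exit-vertex m)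
  exit-not-centre m (j , cj≡o) = independent (suc m) j (subst (Adj T (centre (suc m))) (sym cj≡o) (exit-adj m))

  parent : Fin (suc k) → Fin (suc k)
  parent zero = zero
  parent (suc m) = part (exit-vertex m)

  -- The two edges joining the centre of a star to the centre of its parent.
  data ParentStep (a b : Fin n) : Set where
    out  : ∀ m → a ≡ centre (suc m) → b ≡ exit-vertex m → ParentStep a b
    home : ∀ m → a ≡ exit-vertex m → b ≡ centre (parent (suc m)) → ParentStep a b

  parentStep-adj : ∀ {a b} → ParentStep a b → Adj T a b
  parentStep-adj (out m refl refl) = exit-adj m
  parentStep-adj (home m refl refl) = Adj-sym T (attached (exit-not-centre m))

  to-ancestor : ∀ s t → Star ParentStep (centre s) (centre (iterate parent s t))
  to-ancestor s zero = ε
  to-ancestor zero (suc t) = to-ancestor zero t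
  to-ancestor (suc m) (suc t) = out m refl refl ◅ home m refl refl ◅ to-ancestor (parent (suc m)) t

  -- No star is its own proper ancestor: the walk back would close a cycle
  -- with the exit edge.
  no-return : ∀ m t → iterate parent (parent (suc m)) t ≢ suc m
  no-return m t loop =
    acyclic-edge T acyclic parentStep-adj (exit-adj m) not-back
      (home m refl refl ◅ subst (Star ParentStep _ ∘ centre) loop (to-ancestor (parent (suc m)) t))
    where
      not-back : ¬ ParentStep (exit-vertex m) (centre (suc m))
      not-back (out m′ o≡c _) = exit-not-centre m (suc m′ , sym o≡c)
      not-back (home m′ o≡o′ c≡c′) = exit-leaves m (trans (cong part o≡o′) (sym (centre-injective c≡c′)))

  reaches-root : ∀ s → ∃[ t ] iterate parent s t ≡ zero
  reaches-root s with pigeonhole (ℕ.n<1+n (suc k)) (λ t → iterate parent s (toℕ t))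
  ... | i , j , i<j , same with ℕ.m≤n⇒∃[o]m+o≡n i<j
  ...   | e , i+1+e≡j = toℕ i , fixed⇒root (iterate parent s (toℕ i)) e returns
    where
      fixed⇒root : ∀ r e → iterate parent r (suc e) ≡ r → r ≡ zero
      fixed⇒root zero e _ = refl
      fixed⇒root (suc m) e loop = ⊥-elim (no-return m e loop)
      returns : iterate parent (iterate parent s (toℕ i)) (suc e) ≡ iterate parent s (toℕ i)
      returns = begin
        iterate parent (iterate parent s (toℕ i)) (suc e) ≡⟨ sym (iterate-+ parent s (toℕ i) (suc e)) ⟩
        iterate parent s (toℕ i + suc e)                  ≡⟨ cong (iterate parent s) (trans (ℕ.+-suc (toℕ i) e) i+1+e≡j) ⟩
        iterate parent s (toℕ j)                          ≡⟨ sym same ⟩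
        iterate parent s (toℕ i)                          ∎
        where open ≡-Reasoning

  Spoke : Fin n → Fin n → Set
  Spoke a b = Adj T a b × (IsCentre a ⊎ IsCentre b)

  parentStep⇒spoke : ∀ {a b} → ParentStep a b → Spoke a b
  parentStep⇒spoke ps@(out m a≡c _) = parentStep-adj ps , inj₁ (suc m , sym a≡c)
  parentStep⇒spoke ps@(home m _ b≡c) = parentStep-adj ps , inj₂ (parent (suc m) , sym b≡c)

  spoke-sym : ∀ {a b} → Spoke a b → Spoke b a
  spoke-sym (ab , ends) = Adj-sym T ab , [ inj₂ , inj₁ ] ends

  spokes-to-root : ∀ s → Star Spoke (centre s) (centre zero)
  spokes-to-root s with reaches-root s
  ... | t , reached = subst (Star Spoke _ ∘ centre) reached (Star.map parentStep⇒spoke (to-ancestor s t))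

  -- Every edge meets a centre: an edge uv between non-centres would close
  -- the cycle v, centre of v, …, root centre, …, centre of u, u.
  edge-meets-centre : Covers T centre
  edge-meets-centre {u} {v} uv with isCentre? u | isCentre? v
  ... | yes cu | _ = inj₁ cu
  ... | no _ | yes cv = inj₂ cv
  ... | no ¬cu | no ¬cv = ⊥-elim (acyclic-edge T acyclic proj₁ uv (λ (_ , ends) → [ ¬cv , ¬cu ] ends) walk)
    where
      walk : Star Spoke v u
      walk = (Adj-sym T (attached ¬cv) , inj₂ (part v , refl))
           ◅ spokes-to-root (part v)
           ◅◅ Star.reverse spoke-sym (spokes-to-root (part u))
           ◅◅ (attached ¬cu , inj₁ (part u , refl)) ◅ ε

  tf-bound : ∀ S → TFSet T S → ∣ ∁ S ∣ ≤ suc k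
  tf-bound S tf = cover-bound T centre edge-meets-centre S (proj₁ tf) (λ i → strong-support∈TF T (centreSS i) tf)

  -- Counting vertices star by star, n = m + (k + 1) for the claimed total forcing number m.
  m : ℕ
  m = suc d + k * d

  order : n ≡ m + suc k
  order = begin
    n                                ≡⟨ sym (∑-fibres n (suc k) part) ⟩
    ∑ (suc k) (λ i → ∣ V i ∣)        ≡⟨ cong₂ _+_ (star-size star₁) (∑-cong k (star-size ∘ stars)) ⟩
    suc (suc d) + ∑ k (λ _ → suc d) ≡⟨ cong (suc (suc d) +_) (∑-const k (suc d)) ⟩
    suc (suc d) + k * suc d          ≡⟨ solve 2 (λ d k → con 2 :+ d :+ k :* (con 1 :+ d)
                                                     := (con 1 :+ d :+ k :* d) :+ (con 1 :+ k)) refl d k ⟩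
    m + suc k                        ∎
    where
      open ≡-Reasoning
      open +-*-Solver
      star-size : ∀ {i c s} → IsStar T part i c s → ∣ V i ∣ ≡ suc s
      star-size (_ , _ , _ , size) = size

  formula : suc d * m ≡ d * n + 1
  formula = begin
    suc d * m                ≡⟨ solve 2 (λ d k → (con 1 :+ d) :* (con 1 :+ d :+ k :* d)
                                               := d :* ((con 1 :+ d :+ k :* d) :+ (con 1 :+ k)) :+ con 1) refl d k ⟩
    d * (m + suc k) + 1      ≡⟨ cong (λ x → d * x + 1) (sym order) ⟩
    d * n + 1                ∎
    where
      open ≡-Reasoning
      open +-*-Solver

  lower-bound : ∀ S → TFSet T S → m ≤ ∣ S ∣
  lower-bound S tf = ℕ.+-cancelʳ-≤ (suc k) m ∣ S ∣ (begin
    m + suc k              ≡⟨ trans (sym order) (sym (∣p∣+∣∁p∣≡n S)) ⟩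
    ∣ S ∣ + ∣ ∁ S ∣        ≤⟨ ℕ.+-monoʳ-≤ ∣ S ∣ (tf-bound S tf) ⟩
    ∣ S ∣ + suc k          ∎)
    where open ℕ.≤-Reasoning

  module LeafDeletion (ℓ : Fin (suc k) → Fin n)
                      (leaves : ∀ i → Adj T (centre i) (ℓ i) × IsLeaf T (ℓ i))
                      (S : Subset n)
                      (S-def : ∀ v → (v ∈ S → ∀ i → ℓ i ≢ v) × ((∀ i → ℓ i ≢ v) → v ∈ S)) where

    leaf-owner : ∀ {i j} → Adj T (centre i) (ℓ j) → i ≡ j
    leaf-owner {i} {j} ciℓj =
      centre-injective (leaf-neighbour-unique T (proj₂ (leaves j)) (Adj-sym T ciℓj) (Adj-sym T (proj₁ (leaves j))))

    ℓ-injective : ∀ {i j} → ℓ i ≡ ℓ j → i ≡ j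
    ℓ-injective {i} ℓi≡ℓj = leaf-owner (subst (Adj T (centre i)) ℓi≡ℓj (proj₁ (leaves i)))

    other-neighbour∈S : ∀ {i w} → Adj T (centre i) w → w ≢ ℓ i → w ∈ S
    other-neighbour∈S {i} {w} ciw w≢ℓi = proj₂ (S-def w) λ j ℓj≡w →
      w≢ℓi (trans (sym ℓj≡w) (cong ℓ (sym (leaf-owner (subst (Adj T (centre i)) (sym ℓj≡w) ciw)))))

    centre∈S : ∀ i → centre i ∈ S
    centre∈S i = proj₂ (S-def _) λ j ℓj≡ci → independent j i (subst (Adj T (centre j)) ℓj≡ci (proj₁ (leaves j)))

    forcing : ForcingSet T S
    forcing v with any? (λ i → ℓ i ≟ v)
    ... | no kept = init (proj₂ (S-def v) (λ i ℓi≡v → kept (i , ℓi≡v)))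
    ... | yes (i , refl) = force (proj₁ (leaves i)) (init (centre∈S i))
                                 (λ w ciw w≢ℓi → init (other-neighbour∈S ciw w≢ℓi))

    -- A non-centre sees its centre; a centre keeps one of its two leaves.
    no-isolated : NoIsolatedIn T S
    no-isolated v v∈S with isCentre? v
    ... | no ¬cv = centre (part v) , centre∈S (part v) , Adj-sym T (attached ¬cv)
    ... | yes (i , refl) with centreSS i
    ...   | a , b , a≢b , cia , cib , _ with a ≟ ℓ i
    ...     | no a≢ℓi = a , other-neighbour∈S cia a≢ℓi , cia
    ...     | yes refl = b , other-neighbour∈S cib (λ b≡ℓi → a≢b (sym b≡ℓi)) , cib

    tf : TFSet T S
    tf = forcing , no-isolated

    -- Exactly k + 1 vertices are deleted: at most by the lower bound, at least as the ℓ i are distinct.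
    deleted : ∣ ∁ S ∣ ≡ suc k
    deleted = ℕ.≤-antisym (tf-bound S tf) (injective⇒K≤∣p∣ (suc k) ℓ ℓ-injective (∁ S) ℓ∈∁S)
      where
        ℓ∈∁S : ∀ i → ℓ i ∈ ∁ S
        ℓ∈∁S i = x∉p⇒x∈∁p λ ℓi∈S → proj₁ (S-def _) ℓi∈S i refl

    size : ∣ S ∣ ≡ m
    size = ℕ.+-cancelʳ-≡ (suc k) ∣ S ∣ m (begin
      ∣ S ∣ + suc k    ≡⟨ cong (∣ S ∣ +_) (sym deleted) ⟩
      ∣ S ∣ + ∣ ∁ S ∣  ≡⟨ ∣p∣+∣∁p∣≡n S ⟩
      n                ≡⟨ order ⟩
      m + suc k        ∎)
      where open ≡-Reasoning

    minimum : MinTFSet T S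
    minimum = tf , λ S′ tf′ → subst (_≤ ∣ S′ ∣) (sym size) (lower-bound S′ tf′)

  first-leaf : Fin (suc k) → Fin n
  first-leaf i = proj₁ (some-leaf T (centreSS i))

  canonical : Subset n
  canonical = select (λ v → all? (λ i → ¬? (first-leaf i ≟ v)))

  module Canonical = LeafDeletion first-leaf (proj₂ ∘ some-leaf T ∘ centreSS) canonical
    (λ v → ∈-select⁻ _ , ∈-select⁺ _)

  total-forcing-number : TotalForcingNumber T m
  total-forcing-number = (canonical , Canonical.tf , Canonical.size) , lower-bound

lemma1 : ∀ {n} (T : Graph n) (Δ k : ℕ) → IsTree T → (F : InFamily T Δ k) →
    (∃[ m ] (TotalForcingNumber T m × Δ * m ≡ (Δ ∸ 1) * n + 1))
    × (∀ (ℓ : Fin (suc k) → Fin n) →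
         (∀ i → Adj T (InFamily.centre F i) (ℓ i) × IsLeaf T (ℓ i)) →
         ∀ (S : Subset n) → (∀ v → (v ∈ S → ∀ i → ℓ i ≢ v) × ((∀ i → ℓ i ≢ v) → v ∈ S)) →
         MinTFSet T S)
lemma1 T zero k tree F = ⊥-elim (no-family-with-Δ≡0 F)
lemma1 T (suc d) k tree F =
  (m , total-forcing-number , formula) , λ ℓ leaves S S-def → LeafDeletion.minimum ℓ leaves S S-def
  where open Family (proj₂ tree) F
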